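{- Let $G_1$ be a finite, simple, connected, non-complete graph and let $G_2$ be a finite simple graph. If $k_1(G_1)=k(G_1)$, then $k_1(G_1\circ G_2)=k(G_1\circ G_2)$.
   Context: All graphs are finite, simple and undirected. For a graph $G$, a set $S\subseteq V(G)$ is a vertex-cut of $G$ if $G-S$ is disconnected or $G-S$ is the trivial graph $K_1$. The connectivity $k(G)$ is the minimum cardinality of a vertex-cut of $G$. A vertex-cut $S$ of $G$ is a $k_1$-vertex-cut if $G-S$ has no isolated vertices; the $k_1$-connectivity $k_1(G)$ is the minimum cardinality of a $k_1$-vertex-cut of $G$, with $k_1(G)=\infty$ if no $k_1$-vertex-cut exists. The lexicographic product $G_1\circ G_2$ has vertex set $V(G_1)\times V(G_2)$, where $(x_1,y_1)$ and $(x_2,y_2)$ are adjacent if and only if either $x_1x_2\in E(G_1)$, or $x_1=x_2$ and $y_1y_2\in E(G_2)$. -}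

module Defs where

open import Data.Nat using (ℕ; _≤_; _*_)
open import Data.Bool using (Bool; true; false)
open import Data.Fin using (Fin; remQuot; _≟_)
open import Data.Fin.Subset using (Subset; _∈_; _∉_; ∣_∣)
open import Data.Product using (Σ; ∃; ∃-syntax; _×_; _,_)
open import Data.Sum using (_⊎_)
open import Data.Maybe using (Maybe; just; nothing)
open import Relation.Nullary using (¬_; yes; no)
open import Data.Empty using (⊥-elim)
open import Relation.Binary.PropositionalEquality using (_≡_; _≢_; refl) renaming (sym to ≡-sym)

record Graph (n : ℕ) : Set where
  field
    adj   : Fin n → Fin n → Bool
    sym   : ∀ x y → adj x y ≡ adj y x
    irrefl : ∀ x → adj x x ≡ false
open Graph public

Adj : ∀ {n} → Graph n → Fin n → Fin n → Set
Adj G x y = adj G x y ≡ true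

-- Reach G S x y : there is a path from x to y in G - S
-- (all vertices of the path lie outside S).
data Reach {n} (G : Graph n) (S : Subset n) (x : Fin n) : Fin n → Set where
  here : x ∉ S → Reach G S x x
  step : ∀ {y z} → Reach G S x y → Adj G y z → z ∉ S → Reach G S x z

Connected : ∀ {n} → Graph n → Set
Connected {n} G = Fin n × (∀ x y → Reach G (Data.Fin.Subset.⊥) x y)

NonComplete : ∀ {n} → Graph n → Set
NonComplete G = ∃[ x ] ∃[ y ] (x ≢ y × ¬ Adj G x y)

Disconnected- : ∀ {n} → Graph n → Subset n → Set
Disconnected- G S = ∃[ x ] ∃[ y ] (x ∉ S × y ∉ S × ¬ Reach G S x y)

TrivialK1- : ∀ {n} → Graph n → Subset n → Set
TrivialK1- G S = ∃[ x ] (x ∉ S × (∀ y → y ∉ S → y ≡ x))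

VertexCut : ∀ {n} → Graph n → Subset n → Set
VertexCut G S = Disconnected- G S ⊎ TrivialK1- G S

IsolatedIn- : ∀ {n} → Graph n → Subset n → Fin n → Set
IsolatedIn- G S x = x ∉ S × (∀ y → y ∉ S → ¬ Adj G x y)

K1VertexCut : ∀ {n} → Graph n → Subset n → Set
K1VertexCut G S = VertexCut G S × (∀ x → ¬ IsolatedIn- G S x)

IsConnectivity : ∀ {n} → Graph n → ℕ → Set
IsConnectivity G k =
  (∃[ S ] (VertexCut G S × ∣ S ∣ ≡ k)) × (∀ S → VertexCut G S → k ≤ ∣ S ∣)

-- k₁(G) = k (just k), or k₁(G) = ∞ (nothing) when no k₁-vertex-cut exists.
IsK1Connectivity : ∀ {n} → Graph n → Maybe ℕ → Set
IsK1Connectivity G (just k) =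
  (∃[ S ] (K1VertexCut G S × ∣ S ∣ ≡ k)) × (∀ S → K1VertexCut G S → k ≤ ∣ S ∣)
IsK1Connectivity G nothing = ∀ S → ¬ K1VertexCut G S

lexAdj : ∀ {n₁ n₂} → Graph n₁ → Graph n₂ → Fin n₁ × Fin n₂ → Fin n₁ × Fin n₂ → Bool
lexAdj G H (x₁ , y₁) (x₂ , y₂) with adj G x₁ x₂ | x₁ ≟ x₂
... | true  | _     = true
... | false | yes _ = adj H y₁ y₂
... | false | no _  = false

lexAdj-sym : ∀ {n₁ n₂} (G : Graph n₁) (H : Graph n₂) p q → lexAdj G H p q ≡ lexAdj G H q p
lexAdj-sym G H (x₁ , y₁) (x₂ , y₂) rewrite sym G x₁ x₂ with adj G x₂ x₁ | x₁ ≟ x₂ | x₂ ≟ x₁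
... | true  | _      | _      = refl
... | false | yes _  | yes _  = Graph.sym H y₁ y₂
... | false | yes e  | no ne  = ⊥-elim (ne (≡-sym e))
... | false | no ne  | yes e  = ⊥-elim (ne (≡-sym e))
... | false | no _   | no _   = refl

lexAdj-irrefl : ∀ {n₁ n₂} (G : Graph n₁) (H : Graph n₂) p → lexAdj G H p p ≡ false
lexAdj-irrefl G H (x , y) rewrite irrefl G x with x ≟ x
... | yes _ = irrefl H y
... | no ne = ⊥-elim (ne refl)

_∘ₗ_ : ∀ {n₁ n₂} → Graph n₁ → Graph n₂ → Graph (n₁ * n₂)
_∘ₗ_ {n₁} {n₂} G H = record
  { adj    = λ i j → lexAdj G H (remQuot n₂ i) (remQuot n₂ j)
  ; sym    = λ i j → lexAdj-sym G H (remQuot n₂ i) (remQuot n₂ j)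
  ; irrefl = λ i → lexAdj-irrefl G H (remQuot n₂ i)
  }

-- Let T be a vertex-cut of G₁∘G₂ and C the set of x ∈ V(G₁) whose whole column
-- {x} × V(G₂) lies in T. Every column outside C still has a vertex outside T, so paths
-- of G₁ − C lift to G₁∘G₂ − T; hence C is a vertex-cut of G₁ and
-- |T| ≥ |V(G₂)|·|C| ≥ |V(G₂)|·k(G₁). Conversely, S × V(G₂) is a k₁-vertex-cut of G₁∘G₂
-- for every k₁-vertex-cut S of G₁; for |S| = k₁(G₁) = k(G₁) its size is therefore
-- at most, and being a vertex-cut at least, k(G₁∘G₂).
module Submission where

open import Defs
open import Data.Nat using (suc; _+_; _*_; _≤_)
open import Data.Nat.Properties using (≤-antisym; *-monoʳ-≤; *-suc; *-zeroʳ; module ≤-Reasoning)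
open import Data.Bool using (true; false)
open import Data.Maybe using (just)
open import Data.Product using (∃-syntax; _×_; _,_; proj₁; proj₂)
open import Data.Sum using (inj₁; inj₂; _⊎_)
open import Data.Fin using (Fin; remQuot; combine; _≟_)
open import Data.Fin.Properties using (remQuot-combine; combine-remQuot; any?; all?; ¬∀⟶∃¬)
open import Data.Fin.Subset using (Subset; _∈_; _∉_; ∣_∣; _⊆_; ⊤)
open import Data.Fin.Subset.Properties using (_∈?_; p⊆q⇒∣p∣≤∣q∣; ∣⊤∣≡n; ∣⊥∣≡0)
open import Data.Vec using ([]; _∷_; _++_; replicate; lookup; tabulate; map; concat)
open import Data.Vec.Properties using ([]=⇒lookup; lookup⇒[]=; lookup-concat; lookup-map; lookup-replicate; lookup∘tabulate)
open import Function using (_∘_)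
open import Relation.Nullary using (¬_; yes; no; does; Dec)
open import Relation.Nullary.Decidable using (¬?; _×-dec_; dec-true)
open import Relation.Unary using (Pred; Decidable)
open import Data.Empty using (⊥-elim)
open import Relation.Binary.PropositionalEquality using (_≡_; _≢_; refl; cong; cong₂; subst; subst₂; trans; module ≡-Reasoning) renaming (sym to ≡-sym)

∣p++q∣≡∣p∣+∣q∣ : ∀ {m n} (p : Subset m) (q : Subset n) → ∣ p ++ q ∣ ≡ ∣ p ∣ + ∣ q ∣
∣p++q∣≡∣p∣+∣q∣ []          q = refl
∣p++q∣≡∣p∣+∣q∣ (true ∷ p)  q = cong suc (∣p++q∣≡∣p∣+∣q∣ p q)
∣p++q∣≡∣p∣+∣q∣ (false ∷ p) q = ∣p++q∣≡∣p∣+∣q∣ p q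

satisfying : ∀ {n ℓ} {P : Pred (Fin n) ℓ} → Decidable P → Subset n
satisfying P? = tabulate (does ∘ P?)

module _ {n ℓ} {P : Pred (Fin n) ℓ} (P? : Decidable P) where

  ∈-satisfying⁻ : ∀ {x} → x ∈ satisfying P? → P x
  ∈-satisfying⁻ {x} x∈ with P? x | trans (≡-sym (lookup∘tabulate (does ∘ P?) x)) ([]=⇒lookup x∈)
  ... | yes p | _ = p

  ∉-satisfying⁻ : ∀ {x} → x ∉ satisfying P? → ¬ P x
  ∉-satisfying⁻ {x} x∉ p = x∉ (lookup⇒[]= x _ (trans (lookup∘tabulate (does ∘ P?) x) (dec-true (P? x) p)))

unique⊎another : ∀ {n} (S : Subset n) (x : Fin n) →
                 (∀ z → z ∉ S → z ≡ x) ⊎ ∃[ z ] (z ∉ S × z ≢ x)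
unique⊎another S x with any? (λ z → ¬? (z ∈? S) ×-dec ¬? (z ≟ x))
... | yes another = inj₂ another
... | no ¬another = inj₁ unique
  where
  unique : ∀ z → z ∉ S → z ≡ x
  unique z z∉ with z ≟ x
  ... | yes z≡x = z≡x
  ... | no  z≢x = ⊥-elim (¬another (z , z∉ , z≢x))

-- The blow-up of A ⊆ V(G₁) is A × V(G₂) ⊆ V(G₁ ∘ₗ G₂), in the encoding of remQuot/combine.
blowUp : ∀ {n₁} n₂ → Subset n₁ → Subset (n₁ * n₂)
blowUp n₂ A = concat (map (replicate n₂) A)

∣blowUp∣ : ∀ {n₁} n₂ (A : Subset n₁) → ∣ blowUp n₂ A ∣ ≡ n₂ * ∣ A ∣
∣blowUp∣ n₂ []          = ≡-sym (*-zeroʳ n₂)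
∣blowUp∣ n₂ (true ∷ A)  = begin
  ∣ ⊤ {n₂} ++ blowUp n₂ A ∣     ≡⟨ ∣p++q∣≡∣p∣+∣q∣ (⊤ {n₂}) (blowUp n₂ A) ⟩
  ∣ ⊤ {n₂} ∣ + ∣ blowUp n₂ A ∣  ≡⟨ cong₂ _+_ (∣⊤∣≡n n₂) (∣blowUp∣ n₂ A) ⟩
  n₂ + n₂ * ∣ A ∣               ≡⟨ ≡-sym (*-suc n₂ ∣ A ∣) ⟩
  n₂ * suc ∣ A ∣                ∎
  where open ≡-Reasoning
∣blowUp∣ n₂ (false ∷ A) = begin
  ∣ replicate n₂ false ++ blowUp n₂ A ∣               ≡⟨ ∣p++q∣≡∣p∣+∣q∣ (replicate n₂ false) (blowUp n₂ A) ⟩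
  ∣ replicate n₂ false ∣ + ∣ blowUp n₂ A ∣            ≡⟨ cong₂ _+_ (∣⊥∣≡0 n₂) (∣blowUp∣ n₂ A) ⟩
  n₂ * ∣ A ∣                                          ∎
  where open ≡-Reasoning

module _ {n} {G : Graph n} {S : Subset n} where

  Reach-exit : ∀ {x z} → Reach G S x z → x ≢ z → ∃[ a ] (a ∉ S × Adj G x a)
  Reach-exit (here _) x≢z = ⊥-elim (x≢z refl)
  Reach-exit {x} (step {y} {z} r y~z z∉) x≢z with x ≟ y
  ... | yes refl = z , z∉ , y~z
  ... | no  x≢y  = Reach-exit r x≢y

  K1VertexCut⇒Disconnected- : K1VertexCut G S → Disconnected- G S
  K1VertexCut⇒Disconnected- (inj₁ disconnected , _) = disconnected
  K1VertexCut⇒Disconnected- (inj₂ (x , x∉ , unique) , noIsolated) =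
    ⊥-elim (noIsolated x (x∉ , λ y y∉ x~y → loop (unique y y∉) x~y))
    where
    loop : ∀ {y} → y ≡ x → ¬ Adj G x y
    loop refl x~x with trans (≡-sym (irrefl G x)) x~x
    ... | ()

  VertexCut⇒vertex : VertexCut G S → Fin n
  VertexCut⇒vertex (inj₁ (x , _)) = x
  VertexCut⇒vertex (inj₂ (x , _)) = x

module LexProduct {n₁ n₂} (G₁ : Graph n₁) (G₂ : Graph n₂) where

  col : Fin (n₁ * n₂) → Fin n₁
  col i = proj₁ (remQuot n₂ i)

  row : Fin (n₁ * n₂) → Fin n₂
  row i = proj₂ (remQuot {n₁} n₂ i)

  col-combine : ∀ x y → col (combine x y) ≡ x
  col-combine x y = cong proj₁ (remQuot-combine {n₁} {n₂} x y)

  lookup-blowUp : ∀ (A : Subset n₁) i → lookup (blowUp n₂ A) i ≡ lookup A (col i)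
  lookup-blowUp A i = begin
    lookup (blowUp n₂ A) i                           ≡⟨ cong (lookup (blowUp n₂ A)) (≡-sym (combine-remQuot {n₁} n₂ i)) ⟩
    lookup (blowUp n₂ A) (combine (col i) (row i))   ≡⟨ lookup-concat (map (replicate n₂) A) (col i) (row i) ⟩
    lookup (lookup (map (replicate n₂) A) (col i)) (row i)
                                                     ≡⟨ cong (λ v → lookup v (row i)) (lookup-map (col i) (replicate n₂) A) ⟩
    lookup (replicate n₂ (lookup A (col i))) (row i) ≡⟨ lookup-replicate (row i) (lookup A (col i)) ⟩
    lookup A (col i)                                 ∎
    where open ≡-Reasoning

  ∈-blowUp⁻ : ∀ {A i} → i ∈ blowUp n₂ A → col i ∈ A
  ∈-blowUp⁻ {A} {i} i∈ = lookup⇒[]= (col i) A (trans (≡-sym (lookup-blowUp A i)) ([]=⇒lookup i∈))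

  ∈-blowUp⁺ : ∀ {A i} → col i ∈ A → i ∈ blowUp n₂ A
  ∈-blowUp⁺ {A} {i} x∈ = lookup⇒[]= i (blowUp n₂ A) (trans (lookup-blowUp A i) ([]=⇒lookup x∈))

  adj-∘ₗ⁻ : ∀ {i j} → Adj (G₁ ∘ₗ G₂) i j → Adj G₁ (col i) (col j) ⊎ col i ≡ col j
  adj-∘ₗ⁻ {i} {j} = lexAdj⇒ (remQuot n₂ i) (remQuot n₂ j)
    where
    lexAdj⇒ : ∀ p q → lexAdj G₁ G₂ p q ≡ true → Adj G₁ (proj₁ p) (proj₁ q) ⊎ proj₁ p ≡ proj₁ q
    lexAdj⇒ (x , _) (x' , _) _ with adj G₁ x x' | x ≟ x'
    ... | true  | _        = inj₁ refl
    ... | false | yes x≡x' = inj₂ x≡x'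

  adj-∘ₗ⁺ : ∀ {i j} → Adj G₁ (col i) (col j) → Adj (G₁ ∘ₗ G₂) i j
  adj-∘ₗ⁺ {i} {j} = adj⇒lexAdj (remQuot n₂ i) (remQuot n₂ j)
    where
    adj⇒lexAdj : ∀ p q → Adj G₁ (proj₁ p) (proj₁ q) → lexAdj G₁ G₂ p q ≡ true
    adj⇒lexAdj (x , _) (x' , _) x~x' rewrite x~x' = refl

  reach-col : ∀ {S i j} → Reach (G₁ ∘ₗ G₂) (blowUp n₂ S) i j → Reach G₁ S (col i) (col j)
  reach-col (here i∉) = here (i∉ ∘ ∈-blowUp⁺)
  reach-col (step r y~z z∉) with adj-∘ₗ⁻ y~z
  ... | inj₁ y~z' = step (reach-col r) y~z' (z∉ ∘ ∈-blowUp⁺)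
  ... | inj₂ y≡z  = subst (Reach G₁ _ _) y≡z (reach-col r)

  blowUp-K1VertexCut : ∀ {S} → Fin n₂ → K1VertexCut G₁ S → K1VertexCut (G₁ ∘ₗ G₂) (blowUp n₂ S)
  blowUp-K1VertexCut {S} y cut@(_ , noIsolated) = inj₁ disconnected , λ i → noIsolated (col i) ∘ isolated-col
    where
    ∉blowUp : ∀ {x} → x ∉ S → combine x y ∉ blowUp n₂ S
    ∉blowUp {x} x∉ = x∉ ∘ subst (_∈ S) (col-combine x y) ∘ ∈-blowUp⁻

    disconnected : Disconnected- (G₁ ∘ₗ G₂) (blowUp n₂ S)
    disconnected with K1VertexCut⇒Disconnected- cut
    ... | x , x' , x∉ , x'∉ , ¬r = combine x y , combine x' y , ∉blowUp x∉ , ∉blowUp x'∉ ,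
      ¬r ∘ subst₂ (Reach G₁ S) (col-combine x y) (col-combine x' y) ∘ reach-col

    isolated-col : ∀ {i} → IsolatedIn- (G₁ ∘ₗ G₂) (blowUp n₂ S) i → IsolatedIn- G₁ S (col i)
    isolated-col {i} (i∉ , isolated) = i∉ ∘ ∈-blowUp⁺ , λ x x∉ i~x →
      isolated (combine x y) (∉blowUp x∉) (adj-∘ₗ⁺ (subst (Adj G₁ (col i)) (≡-sym (col-combine x y)) i~x))

  module FullColumns (T : Subset (n₁ * n₂)) where

    full? : (x : Fin n₁) → Dec ((y : Fin n₂) → combine x y ∈ T)
    full? x = all? (λ y → combine x y ∈? T)

    fullColumns : Subset n₁
    fullColumns = satisfying full?

    blowUp-fullColumns⊆ : blowUp n₂ fullColumns ⊆ T
    blowUp-fullColumns⊆ {i} i∈ =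
      subst (_∈ T) (combine-remQuot {n₁} n₂ i) (∈-satisfying⁻ full? (∈-blowUp⁻ i∈) (row i))

    ∉fullColumns⇒ : ∀ {x} → x ∉ fullColumns → ∃[ y ] (combine x y ∉ T)
    ∉fullColumns⇒ {x} x∉ = ¬∀⟶∃¬ n₂ _ (λ y → combine x y ∈? T) (∉-satisfying⁻ full? x∉)

    col∉fullColumns : ∀ {i} → i ∉ T → col i ∉ fullColumns
    col∉fullColumns {i} i∉ x∈ = i∉ (blowUp-fullColumns⊆ (∈-blowUp⁺ x∈))

    reach-lift : ∀ {i x} → Reach G₁ fullColumns (col i) x → i ∉ T →
                 ∃[ k ] (col k ≡ x × Reach (G₁ ∘ₗ G₂) T i k)
    reach-lift (here _) i∉ = _ , refl , here i∉
    reach-lift (step {z = x} r m~x x∉) i∉ with reach-lift r i∉ | ∉fullColumns⇒ x∉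
    ... | k , refl , i⇝k | y , xy∉ =
      combine x y , col-combine x y ,
      step i⇝k (adj-∘ₗ⁺ (subst (Adj G₁ (col k)) (≡-sym (col-combine x y)) m~x)) xy∉

    reach-lift-distinct : ∀ {i j} → Reach G₁ fullColumns (col i) (col j) → col i ≢ col j →
                          i ∉ T → j ∉ T → Reach (G₁ ∘ₗ G₂) T i j
    reach-lift-distinct {i} {j} r cᵢ≢cⱼ i∉ j∉ = lift r cᵢ≢cⱼ refl
      where
      lift : ∀ {x} → Reach G₁ fullColumns (col i) x → col i ≢ x → col j ≡ x → Reach (G₁ ∘ₗ G₂) T i j
      lift (here _) cᵢ≢cᵢ _ = ⊥-elim (cᵢ≢cᵢ refl)
      lift (step r m~cⱼ _) _ refl with reach-lift r i∉
      ... | k , refl , i⇝k = step i⇝k (adj-∘ₗ⁺ m~cⱼ) j∉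

    reach-lift-same : ∀ {i j a} → col i ≡ col j → Adj G₁ (col i) a → a ∉ fullColumns →
                      i ∉ T → j ∉ T → Reach (G₁ ∘ₗ G₂) T i j
    reach-lift-same {i} {j} {a} cᵢ≡cⱼ i~a a∉ i∉ j∉ with ∉fullColumns⇒ a∉
    ... | y , ay∉ = step (step (here i∉) (adj-∘ₗ⁺ i~ay) ay∉) (adj-∘ₗ⁺ ay~j) j∉
      where
      i~ay : Adj G₁ (col i) (col (combine a y))
      i~ay = subst (Adj G₁ (col i)) (≡-sym (col-combine a y)) i~a
      ay~j : Adj G₁ (col (combine a y)) (col j)
      ay~j = subst₂ (Adj G₁) (≡-sym (col-combine a y)) cᵢ≡cⱼ (trans (Graph.sym G₁ a (col i)) i~a)

    fullColumns-VertexCut : VertexCut (G₁ ∘ₗ G₂) T → VertexCut G₁ fullColumns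
    fullColumns-VertexCut (inj₂ (i , i∉ , unique)) = inj₂ (col i , col∉fullColumns i∉ , onlyCol)
      where
      onlyCol : ∀ x → x ∉ fullColumns → x ≡ col i
      onlyCol x x∉ with ∉fullColumns⇒ x∉
      ... | y , xy∉ = trans (≡-sym (col-combine x y)) (cong col (unique _ xy∉))
    fullColumns-VertexCut (inj₁ (i , j , i∉ , j∉ , ¬i⇝j)) with col i ≟ col j
    ... | no cᵢ≢cⱼ = inj₁ (col i , col j , col∉fullColumns i∉ , col∉fullColumns j∉ ,
                           λ r → ¬i⇝j (reach-lift-distinct r cᵢ≢cⱼ i∉ j∉))
    -- If i and j share a column, a path from it to another non-full column would leave
    -- through a non-full neighbouring column, and i, j are both adjacent to that column.
    ... | yes cᵢ≡cⱼ with unique⊎another fullColumns (col i)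
    ...   | inj₁ onlyCol = inj₂ (col i , col∉fullColumns i∉ , onlyCol)
    ...   | inj₂ (x , x∉ , x≢cᵢ) = inj₁ (col i , x , col∉fullColumns i∉ , x∉ , ¬cᵢ⇝x)
      where
      ¬cᵢ⇝x : ¬ Reach G₁ fullColumns (col i) x
      ¬cᵢ⇝x r with Reach-exit r (x≢cᵢ ∘ ≡-sym)
      ... | a , a∉ , cᵢ~a = ¬i⇝j (reach-lift-same cᵢ≡cⱼ cᵢ~a a∉ i∉ j∉)

  ∣VertexCut∣-lowerBound : ∀ {k T} → (∀ S → VertexCut G₁ S → k ≤ ∣ S ∣) →
                            VertexCut (G₁ ∘ₗ G₂) T → n₂ * k ≤ ∣ T ∣
  ∣VertexCut∣-lowerBound {k} {T} κ≤ T-cut = begin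
    n₂ * k                       ≤⟨ *-monoʳ-≤ n₂ (κ≤ fullColumns (fullColumns-VertexCut T-cut)) ⟩
    n₂ * ∣ fullColumns ∣         ≡⟨ ∣blowUp∣ n₂ fullColumns ⟨
    ∣ blowUp n₂ fullColumns ∣    ≤⟨ p⊆q⇒∣p∣≤∣q∣ blowUp-fullColumns⊆ ⟩
    ∣ T ∣                        ∎
    where
    open FullColumns T
    open ≤-Reasoning

theorem2p2 : ∀ {n₁ n₂} (G₁ : Graph n₁) (G₂ : Graph n₂)
    → Connected G₁ → NonComplete G₁
    → (∃[ k ] (IsConnectivity G₁ k × IsK1Connectivity G₁ (just k)))
    → ∀ k → IsConnectivity (G₁ ∘ₗ G₂) k → IsK1Connectivity (G₁ ∘ₗ G₂) (just k)
theorem2p2 {n₂ = n₂} G₁ G₂ _ _ (k₁ , (_ , κ₁≤) , (S , S-cut , ∣S∣≡k₁) , _) k ((T , T-cut , ∣T∣≡k) , κ≤) =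
  (blowUp n₂ S , S×-cut , ≤-antisym ∣S×∣≤k (κ≤ _ (proj₁ S×-cut))) , λ S' S'-cut → κ≤ S' (proj₁ S'-cut)
  where
  open LexProduct G₁ G₂
  S×-cut : K1VertexCut (G₁ ∘ₗ G₂) (blowUp n₂ S)
  S×-cut = blowUp-K1VertexCut (row (VertexCut⇒vertex T-cut)) S-cut
  ∣S×∣≤k : ∣ blowUp n₂ S ∣ ≤ k
  ∣S×∣≤k = begin
    ∣ blowUp n₂ S ∣  ≡⟨ ∣blowUp∣ n₂ S ⟩
    n₂ * ∣ S ∣       ≡⟨ cong (n₂ *_) ∣S∣≡k₁ ⟩
    n₂ * k₁          ≤⟨ ∣VertexCut∣-lowerBound κ₁≤ T-cut ⟩
    ∣ T ∣            ≡⟨ ∣T∣≡k ⟩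
    k                ∎
    where open ≤-Reasoning
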